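{- Let $M,n\geq 3$ with $n$ odd, and let $0\leq\beta\leq n$ and $\alpha=n-\beta$. Then $(\alpha,\beta)\in\mathrm{HWP}(C_M[n];M,Mn)$, except possibly when $\beta=1$.
   Context: For a graph $G$ and positive integer $n$, $G[n]$ denotes the lexicographic product of $G$ with the empty graph on $n$ vertices (vertex set $V(G)\times\mathbb{Z}_n$, with $(x,i)(y,j)$ an edge iff $xy\in E(G)$); $C_M$ is a cycle of length $M$, so $C_M[n]$ is $2n$-regular. A $C_\ell$-factor of a graph $G$ is a spanning subgraph of $G$ that is a vertex-disjoint union of $\ell$-cycles. $\mathrm{HWP}(G;M,N)$ denotes the set of pairs $(\alpha,\beta)$ of non-negative integers for which $E(G)$ can be partitioned into $\alpha$ $C_M$-factors and $\beta$ $C_N$-factors. -}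

module Defs where

open import Data.Nat using (ℕ; zero; suc; _%_)
open import Data.Nat.DivMod using (m%n<n)
open import Data.Fin using (Fin; toℕ; fromℕ<)
open import Data.Product using (Σ; _×_; _,_; ∃; ∃-syntax; ∃!)
open import Data.Sum using (_⊎_)
open import Relation.Binary.PropositionalEquality using (_≡_)
open import Function.Definitions using (Bijective)

next : ∀ {ℓ} → Fin ℓ → Fin ℓ
next {suc k} i = fromℕ< (m%n<n (suc (toℕ i)) (suc k))

CycleAdj : (M : ℕ) → Fin M → Fin M → Set
CycleAdj M x y = (next x ≡ y) ⊎ (next y ≡ x)

LexV : ℕ → ℕ → Set
LexV M n = Fin M × Fin n

LexAdj : (M n : ℕ) → LexV M n → LexV M n → Set
LexAdj M n (x , i) (y , j) = CycleAdj M x y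

-- Cycle c is vtx(c,0) vtx(c,1) ... vtx(c,ℓ-1); vtx is a bijection
-- Fin k × Fin ℓ → V (distinct vertices, disjoint cycles, spanning), and
-- consecutive vertices (cyclically) are adjacent in the graph.
record CFactor (V : Set) (Adj : V → V → Set) (ℓ : ℕ) : Set where
  field
    k    : ℕ
    vtx  : Fin k × Fin ℓ → V
    bij  : Bijective _≡_ _≡_ vtx
    adj  : ∀ c p → Adj (vtx (c , p)) (vtx (c , next p))

EdgeOf : ∀ {V Adj ℓ} → CFactor V Adj ℓ → V → V → Set
EdgeOf F u v = ∃ λ c → ∃ λ p →
  ((vtx (c , p) ≡ u) × (vtx (c , next p) ≡ v)) ⊎
  ((vtx (c , p) ≡ v) × (vtx (c , next p) ≡ u))
  where open CFactor F

-- (α,β) ∈ HWP(G;M,N): E(G) is partitioned into α C_M-factors and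
-- β C_N-factors, i.e. every edge of G lies in exactly one of the factors.
HWP : (V : Set) (Adj : V → V → Set) (M N α β : ℕ) → Set
HWP V Adj M N α β =
  Σ (Fin α → CFactor V Adj M) λ F → Σ (Fin β → CFactor V Adj N) λ G → ∀ u v → Adj u v →
     ∃! _≡_ (λ (t : Fin α ⊎ Fin β) → Edge F G t u v)
  where
  Edge : (Fin α → CFactor V Adj M) → (Fin β → CFactor V Adj N) →
         Fin α ⊎ Fin β → V → V → Set
  Edge F G (Data.Sum.inj₁ a) u v = EdgeOf (F a) u v
  Edge F G (Data.Sum.inj₂ b) u v = EdgeOf (G b) u v

module Submission where

-- An edge (x, i)(x + 1, j) of C_M[n] has shift j - i ∈ ℤ_n.  A shift
-- sequence δ selects at each layer x the edges of shift δ x; these form a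
-- 2-factor whose cycle structure depends only on the total shift
-- S = δ 0 + … + δ (M - 1): it is n cycles of length M if S ≡ 0 and a single
-- Hamiltonian cycle if S is a unit mod n.  It therefore suffices to find n
-- shift sequences d t (t < n) that use every shift exactly once at every
-- layer, with total shift 0 for t ≥ β and a unit for t < β.  We take
-- d t 0 = π t and d t x = e x * t for x > 0, where the units e x (e 0 = 1)
-- sum to 0 mod n and π permutes ℕ, fixing every t ≥ β and moving every
-- t < β by +1, -1 or -2; then the total shift of d t is π t - t, and -2 is
-- a unit because n is odd.  Such a π exists exactly when β ≠ 1.

open import Defs
open import Data.Nat using (ℕ; zero; suc; _+_; _*_; _∸_; _%_; _/_; _≤_; _<_; z≤n; s≤s; NonZero)
open import Data.Nat.Properties
open import Data.Nat.DivMod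
open import Data.Nat.Divisibility using (m∣m*n)
open import Data.Nat.Tactic.RingSolver using (solve-∀)
open import Data.Fin using (Fin; toℕ; fromℕ<; zero)
open import Data.Fin.Properties using (toℕ-injective; toℕ-fromℕ<; toℕ<n)
open import Data.Product using (Σ; ∃!; _×_; _,_; proj₁; proj₂)
open import Data.Sum using (_⊎_; inj₁; inj₂)
open import Data.Empty using (⊥-elim)
open import Relation.Nullary using (yes; no)
open import Relation.Binary.PropositionalEquality hiding (setoid)
open import Relation.Binary.Bundles using (Setoid)
import Relation.Binary.Reasoning.Setoid as SetoidReasoning
open import Function using (case_of_)
open import Function.Definitions using (Bijective)
open import Function.Consequences.Propositional
  using (inverseᵇ⇒bijective; strictlyInverseˡ⇒inverseˡ; strictlyInverseʳ⇒inverseʳ)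

-- Congruence of natural numbers modulo N = suc N'.  Residues are
-- represented by natural numbers, and -x by N' * x.
module Congruence (N' : ℕ) where
  N : ℕ
  N = suc N'

  -- a record, so that Agda can recover a and b from a proof of a ≈ b
  infix 4 _≈_
  record _≈_ (a b : ℕ) : Set where
    constructor mk
    field get : a % N ≡ b % N
  open _≈_ public

  ≈-refl : ∀ {a} → a ≈ a
  ≈-refl = mk refl

  ≈-sym : ∀ {a b} → a ≈ b → b ≈ a
  ≈-sym (mk p) = mk (sym p)

  ≈-trans : ∀ {a b c} → a ≈ b → b ≈ c → a ≈ c
  ≈-trans (mk p) (mk q) = mk (trans p q)

  ≡⇒≈ : ∀ {a b} → a ≡ b → a ≈ b
  ≡⇒≈ refl = ≈-refl

  setoid : Setoid _ _
  setoid = record { Carrier = ℕ ; _≈_ = _≈_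
    ; isEquivalence = record { refl = ≈-refl ; sym = ≈-sym ; trans = ≈-trans } }

  module ≈-Reasoning = SetoidReasoning setoid

  +-cong : ∀ {a b c d} → a ≈ b → c ≈ d → a + c ≈ b + d
  +-cong {a} {b} {c} {d} (mk p) (mk q) = mk (begin
    (a + c) % N             ≡⟨ %-distribˡ-+ a c N ⟩
    (a % N + c % N) % N     ≡⟨ cong₂ (λ x y → (x + y) % N) p q ⟩
    (b % N + d % N) % N     ≡⟨ %-distribˡ-+ b d N ⟨
    (b + d) % N             ∎)
    where open ≡-Reasoning

  *-cong : ∀ {a b c d} → a ≈ b → c ≈ d → a * c ≈ b * d
  *-cong {a} {b} {c} {d} (mk p) (mk q) = mk (begin
    (a * c) % N             ≡⟨ %-distribˡ-* a c N ⟩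
    (a % N * (c % N)) % N   ≡⟨ cong₂ (λ x y → (x * y) % N) p q ⟩
    (b % N * (d % N)) % N   ≡⟨ %-distribˡ-* b d N ⟨
    (b * d) % N             ∎)
    where open ≡-Reasoning

  +-congˡ : ∀ a {b c} → b ≈ c → a + b ≈ a + c
  +-congˡ a = +-cong (≈-refl {a})

  +-congʳ : ∀ {a b} c → a ≈ b → a + c ≈ b + c
  +-congʳ c p = +-cong p (≈-refl {c})

  *-congˡ : ∀ a {b c} → b ≈ c → a * b ≈ a * c
  *-congˡ a = *-cong (≈-refl {a})

  *-congʳ : ∀ {a b} c → a ≈ b → a * c ≈ b * c
  *-congʳ c p = *-cong p (≈-refl {c})

  %-≈ : ∀ a → a % N ≈ a
  %-≈ a = mk (m%n%n≡m%n a N)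

  +-multiple : ∀ a k → a + k * N ≈ a
  +-multiple a k = mk ([m+kn]%n≡m%n a k N)

  %-multiple-≈ : ∀ a k → a % (N * suc k) ≈ a
  %-multiple-≈ a k = mk (m∣n⇒o%n%m≡o%m N (N * suc k) a (m∣m*n (suc k)))

  canonical : ∀ {a b} → a < N → b < N → a ≈ b → a ≡ b
  canonical {a} {b} a<N b<N (mk p) = trans (sym (m<n⇒m%n≡m a<N)) (trans p (m<n⇒m%n≡m b<N))

  +-cancelʳ : ∀ {a b c} → a + c ≈ b + c → a ≈ b
  +-cancelʳ {a} {b} {c} p = begin
    a                  ≈⟨ +-multiple a c ⟨
    a + c * N          ≡⟨ shuffle a c N' ⟩
    a + c + N' * c     ≈⟨ +-congʳ (N' * c) p ⟩
    b + c + N' * c     ≡⟨ shuffle b c N' ⟨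
    b + c * N          ≈⟨ +-multiple b c ⟩
    b                  ∎
    where
    open ≈-Reasoning
    shuffle : ∀ x c N' → x + c * (1 + N') ≡ x + c + N' * c
    shuffle = solve-∀

  +-cancelˡ : ∀ {a b c} → c + a ≈ c + b → a ≈ b
  +-cancelˡ {a} {b} {c} p = +-cancelʳ (≈-trans (≡⇒≈ (+-comm a c)) (≈-trans p (≡⇒≈ (+-comm c b))))

  subtract-add : ∀ a b → a + N' * b + b ≈ a
  subtract-add a b = ≈-trans (≡⇒≈ (shuffle a b N')) (+-multiple a b)
    where
    shuffle : ∀ a b N' → a + N' * b + b ≡ a + b * (1 + N')
    shuffle = solve-∀

  add-subtract : ∀ a b → a + b + N' * b ≈ a
  add-subtract a b = ≈-trans (≡⇒≈ (shuffle a b N')) (+-multiple a b)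
    where
    shuffle : ∀ a b N' → a + b + N' * b ≡ a + b * (1 + N')
    shuffle = solve-∀

  reduce : ℕ → Fin N
  reduce a = fromℕ< (m%n<n a N)

  toℕ-reduce : ∀ a → toℕ (reduce a) ≈ a
  toℕ-reduce a = ≈-trans (≡⇒≈ (toℕ-fromℕ< (m%n<n a N))) (%-≈ a)

  reduce-≈ : ∀ {a} {j : Fin N} → a ≈ toℕ j → reduce a ≡ j
  reduce-≈ {a} {j} (mk p) = toℕ-injective (trans (toℕ-fromℕ< (m%n<n a N)) (trans p (m<n⇒m%n≡m (toℕ<n j))))

  Unit : ℕ → Set
  Unit x = Σ ℕ λ u → u * x ≈ 1

  unit-cancel : ∀ x (u : Unit x) t → proj₁ u * (x * t) ≈ t
  unit-cancel x (w , wx) t = begin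
    w * (x * t)   ≡⟨ *-assoc w x t ⟨
    w * x * t     ≈⟨ *-congʳ t wx ⟩
    1 * t         ≡⟨ *-identityˡ t ⟩
    t             ∎
    where open ≈-Reasoning

  unit-one : ∀ {x} → x ≈ 1 → Unit x
  unit-one {x} p = 1 , ≈-trans (≡⇒≈ (+-identityʳ x)) p

  unit-of-negative : ∀ {x} c w → w * c ≡ N' → x + c ≈ 0 → Unit x
  unit-of-negative {x} c w wc p = w , (begin
    w * x                   ≈⟨ +-multiple (w * x) 1 ⟨
    w * x + 1 * N           ≡⟨ cong (λ z → w * x + 1 * (1 + z)) wc ⟨
    w * x + 1 * (1 + w * c) ≡⟨ expand w x c ⟩
    w * (x + c) + 1         ≈⟨ +-congʳ 1 (*-congˡ w p) ⟩
    w * 0 + 1               ≡⟨ cong (_+ 1) (*-zeroʳ w) ⟩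
    1                       ∎)
    where
    open ≈-Reasoning
    expand : ∀ w x c → w * x + 1 * (1 + w * c) ≡ w * (x + c) + 1
    expand = solve-∀

bijection : {A B : Set} (f : A → B) (g : B → A) →
  (∀ a → g (f a) ≡ a) → (∀ b → f (g b) ≡ b) → Bijective _≡_ _≡_ f
bijection f g gf fg =
  inverseᵇ⇒bijective (strictlyInverseˡ⇒inverseˡ f fg , strictlyInverseʳ⇒inverseʳ f gf)

toℕ-next : ∀ {k} (x : Fin (suc k)) → toℕ (next x) ≡ suc (toℕ x) % suc k
toℕ-next {k} x = toℕ-fromℕ< (m%n<n (suc (toℕ x)) (suc k))

next-cases : ∀ {k} (p : Fin (suc k)) →
  (toℕ (next p) ≡ suc (toℕ p)) ⊎ (toℕ (next p) ≡ 0 × suc (toℕ p) ≡ suc k)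
next-cases {k} p with m≤n⇒m<n∨m≡n (toℕ<n p)
... | inj₁ lt = inj₁ (trans (toℕ-next p) (m<n⇒m%n≡m lt))
... | inj₂ eq = inj₂ (trans (toℕ-next p) (trans (cong (_% suc k) eq) (n%n≡0 (suc k))) , eq)

-- In a cycle of length at least 3 the two neighbours of a vertex are
-- distinct, so no edge of C_M is traversed in both directions.
next²≢id : ∀ {M'} → 3 ≤ suc M' → (x : Fin (suc M')) → next (next x) ≢ x
next²≢id {M'} M>2 x eq = 2≢0 (canonical M>2 (s≤s z≤n) (+-cancelʳ two-steps))
  where
  open Congruence M'
  open ≈-Reasoning
  2≢0 : 2 ≢ 0
  2≢0 ()
  two-steps : 2 + toℕ x ≈ 0 + toℕ x
  two-steps = begin
    2 + toℕ x                 ≈⟨ +-congˡ 1 (%-≈ (suc (toℕ x))) ⟨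
    1 + suc (toℕ x) % N       ≈⟨ %-≈ _ ⟨
    (1 + suc (toℕ x) % N) % N ≡⟨ cong (λ z → suc z % N) (toℕ-next x) ⟨
    suc (toℕ (next x)) % N    ≡⟨ toℕ-next (next x) ⟨
    toℕ (next (next x))       ≡⟨ cong toℕ eq ⟩
    toℕ x                     ∎

sumTo : (ℕ → ℕ) → ℕ → ℕ
sumTo f zero = 0
sumTo f (suc p) = sumTo f p + f p

div-mod-unique : ∀ {q} m p k .{{_ : NonZero m}} → p < m → q ≡ p + k * m → q % m ≡ p × q / m ≡ k
div-mod-unique m p k p<m refl = remainder , quotient
  where
  remainder : (p + k * m) % m ≡ p
  remainder = trans ([m+kn]%n≡m%n p k m) (m<n⇒m%n≡m p<m)
  quotient : (p + k * m) / m ≡ k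
  quotient = *-cancelʳ-≡ _ k m (+-cancelˡ-≡ p _ _ (sym (begin
    p + k * m                                 ≡⟨ m≡m%n+[m/n]*n (p + k * m) m ⟩
    (p + k * m) % m + (p + k * m) / m * m     ≡⟨ cong (_+ (p + k * m) / m * m) remainder ⟩
    p + (p + k * m) / m * m                   ∎)))
    where open ≡-Reasoning

mixed-radix-bound : ∀ {m n x k} → x < m → k < n → x + k * m < m * n
mixed-radix-bound {m} {n} {x} {k} x<m k<n = begin-strict
  x + k * m    <⟨ +-monoˡ-< (k * m) x<m ⟩
  m + k * m    ≤⟨ *-monoˡ-≤ m k<n ⟩
  n * m        ≡⟨ *-comm n m ⟩
  m * n        ∎
  where open ≤-Reasoning

EdgeOf-sym : ∀ {V Adj ℓ} (F : CFactor V Adj ℓ) {u v} → EdgeOf F u v → EdgeOf F v u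
EdgeOf-sym F (c , p , inj₁ e) = c , p , inj₂ e
EdgeOf-sym F (c , p , inj₂ e) = c , p , inj₁ e

-- A shift sequence δ (the shift δ x ∈ ℤ_n used
-- between layers x and x + 1) determines the spanning subgraph of δ-arcs
-- (x, i) → (x + 1, i + δ x); every vertex has exactly one outgoing and one
-- incoming δ-arc.  Its cycle structure depends only on the total shift
-- S = δ 0 + ... + δ (M - 1): for S ≡ 0 it consists of n cycles of length M,
-- and for S a unit mod n it is a single Hamiltonian cycle of length M n.
module ShiftFactors (M' np : ℕ) where
  M n : ℕ
  M = suc M'
  n = suc np

  open Congruence np
  module ModM = Congruence M'

  V : Set
  V = LexV M n

  Adj : V → V → Set
  Adj = LexAdj M n

  record Arc (δ : ℕ → ℕ) (u v : V) : Set where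
    constructor arc
    field
      layer : next (proj₁ u) ≡ proj₁ v
      shift : toℕ (proj₂ u) + δ (toℕ (proj₁ u)) ≈ toℕ (proj₂ v)

  Arc-functional : ∀ {δ u v w} → Arc δ u v → Arc δ u w → v ≡ w
  Arc-functional (arc l s) (arc l' s') =
    cong₂ _,_ (trans (sym l) l') (toℕ-injective (canonical (toℕ<n _) (toℕ<n _) (≈-trans (≈-sym s) s')))

  total : (ℕ → ℕ) → ℕ
  total δ = sumTo δ M

  ShiftFactor : (ℕ → ℕ) → ℕ → Set
  ShiftFactor δ ℓ = Σ (CFactor V Adj ℓ) λ F →
    ∀ c p → Arc δ (CFactor.vtx F (c , p)) (CFactor.vtx F (c , next p))

  shiftFactor : ∀ {δ k ℓ} (vertex : Fin k × Fin ℓ → V) (position : V → Fin k × Fin ℓ) →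
    (∀ a → position (vertex a) ≡ a) → (∀ v → vertex (position v) ≡ v) →
    (∀ c p → Arc δ (vertex (c , p)) (vertex (c , next p))) → ShiftFactor δ ℓ
  shiftFactor {k = k} vertex position left right follows =
    record { k = k ; vtx = vertex ; bij = bijection vertex position left right
           ; adj = λ c p → inj₁ (Arc.layer (follows c p)) } , follows

  module Edges {δ ℓ} (SF : ShiftFactor δ ℓ) where
    open CFactor (proj₁ SF)

    edge⇒arc : ∀ {u v} → EdgeOf (proj₁ SF) u v → Arc δ u v ⊎ Arc δ v u
    edge⇒arc (c , p , inj₁ (refl , refl)) = inj₁ (proj₂ SF c p)
    edge⇒arc (c , p , inj₂ (refl , refl)) = inj₂ (proj₂ SF c p)

    arc⇒edge : ∀ {u v} → Arc δ u v → EdgeOf (proj₁ SF) u v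
    arc⇒edge {u} a with proj₂ bij u
    ... | (c , p) , hits = c , p , inj₁ (hits refl ,
          Arc-functional (subst (λ w → Arc δ w (vtx (c , next p))) (hits refl) (proj₂ SF c p)) a)

  -- Total shift 0: cycle c visits (p, c + δ 0 + ... + δ (p - 1)) at position p.
  module ShortCycles (δ : ℕ → ℕ) (total≈0 : total δ ≈ 0) where
    D : ℕ → ℕ
    D = sumTo δ

    -- partial sums advance by δ along C_M, also at the wrap-around M - 1 → 0
    D-next : ∀ p → D (toℕ (next p)) ≈ D (toℕ p) + δ (toℕ p)
    D-next p with next-cases p
    ... | inj₁ incremented = ≡⇒≈ (cong D incremented)
    ... | inj₂ (wrapped , last) =
          ≈-trans (≡⇒≈ (cong D wrapped)) (≈-trans (≈-sym total≈0) (≡⇒≈ (cong D (sym last))))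

    vertex : Fin n × Fin M → V
    vertex (c , p) = p , reduce (toℕ c + D (toℕ p))

    position : V → Fin n × Fin M
    position (x , j) = reduce (toℕ j + np * D (toℕ x)) , x

    position-vertex : ∀ a → position (vertex a) ≡ a
    position-vertex (c , p) = cong (_, p) (reduce-≈ (begin
      toℕ (reduce (toℕ c + D (toℕ p))) + np * D (toℕ p) ≈⟨ +-congʳ (np * D (toℕ p)) (toℕ-reduce _) ⟩
      toℕ c + D (toℕ p) + np * D (toℕ p)                 ≈⟨ add-subtract (toℕ c) (D (toℕ p)) ⟩
      toℕ c                                              ∎))
      where open ≈-Reasoning

    vertex-position : ∀ v → vertex (position v) ≡ v
    vertex-position (x , j) = cong (x ,_) (reduce-≈ (begin
      toℕ (reduce (toℕ j + np * D (toℕ x))) + D (toℕ x) ≈⟨ +-congʳ (D (toℕ x)) (toℕ-reduce _) ⟩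
      toℕ j + np * D (toℕ x) + D (toℕ x)                 ≈⟨ subtract-add (toℕ j) (D (toℕ x)) ⟩
      toℕ j                                              ∎))
      where open ≈-Reasoning

    follows : ∀ c p → Arc δ (vertex (c , p)) (vertex (c , next p))
    follows c p = arc refl (begin
      toℕ (reduce (toℕ c + D (toℕ p))) + δ (toℕ p) ≈⟨ +-congʳ (δ (toℕ p)) (toℕ-reduce _) ⟩
      toℕ c + D (toℕ p) + δ (toℕ p)                ≡⟨ +-assoc (toℕ c) _ _ ⟩
      toℕ c + (D (toℕ p) + δ (toℕ p))              ≈⟨ +-congˡ (toℕ c) (D-next p) ⟨
      toℕ c + D (toℕ (next p))                     ≈⟨ toℕ-reduce _ ⟨
      toℕ (reduce (toℕ c + D (toℕ (next p))))      ∎)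
      where open ≈-Reasoning

    shortFactor : ShiftFactor δ M
    shortFactor = shiftFactor vertex position position-vertex vertex-position follows

  -- Total shift a unit S (with u * S ≡ 1): following the δ-arcs from (0, 0),
  -- step q reaches layer q mod M at height q / M * S + D (q mod M), and the
  -- lap q / M can be recovered from the height, so all M n vertices are visited.
  module LongCycle (δ : ℕ → ℕ) (u : ℕ) (u-inverse : u * total δ ≈ 1) where
    D : ℕ → ℕ
    D = sumTo δ

    S : ℕ
    S = total δ

    height : ℕ → ℕ
    height q = q / M * S + D (q % M)

    height-within : ∀ p k → p < M → height (p + k * M) ≡ k * S + D p
    height-within p k p<M with div-mod-unique M p k p<M refl
    ... | remainder , quotient = cong₂ (λ r d → d * S + D r) remainder quotient

    -- p = M is allowed: completing a lap adds exactly S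
    height-at : ∀ p k → p ≤ M → height (p + k * M) ≡ k * S + D p
    height-at p k p≤M with m≤n⇒m<n∨m≡n p≤M
    ... | inj₁ p<M = height-within p k p<M
    ... | inj₂ refl = trans (height-within 0 (suc k) (s≤s z≤n))
                            (trans (+-identityʳ (S + k * S)) (+-comm S (k * S)))

    height-suc : ∀ q → height (suc q) ≡ height q + δ (q % M)
    height-suc q = begin
      height (suc q)                             ≡⟨ cong (λ z → height (suc z)) (m≡m%n+[m/n]*n q M) ⟩
      height (suc (q % M) + q / M * M)           ≡⟨ height-at (suc (q % M)) (q / M) (m%n<n q M) ⟩
      q / M * S + (D (q % M) + δ (q % M))        ≡⟨ +-assoc (q / M * S) _ _ ⟨
      height q + δ (q % M)                       ∎
      where open ≡-Reasoning

    -- after M n steps the height has changed by n S ≡ 0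
    height-periodic : ∀ q → height (q % (M * n)) ≈ height q
    height-periodic q = begin
      height r                          ≡⟨ cong height (m≡m%n+[m/n]*n r M) ⟩
      height (r % M + r / M * M)        ≡⟨ height-at (r % M) (r / M) (<⇒≤ (m%n<n r M)) ⟩
      r / M * S + D (r % M)             ≈⟨ +-multiple _ (c * S) ⟨
      r / M * S + D (r % M) + c * S * n ≡⟨ regroup (r / M) c S (D (r % M)) n ⟩
      (r / M + c * n) * S + D (r % M)   ≡⟨ height-at (r % M) (r / M + c * n) (<⇒≤ (m%n<n r M)) ⟨
      height (r % M + (r / M + c * n) * M) ≡⟨ cong height digits ⟨
      height q                          ∎
      where
      open ≈-Reasoning
      r = q % (M * n)
      c = q / (M * n)
      regroup : ∀ k c S D n → k * S + D + c * S * n ≡ (k + c * n) * S + D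
      regroup = solve-∀
      digits : q ≡ r % M + (r / M + c * n) * M
      digits = trans (m≡m%n+[m/n]*n q (M * n))
        (trans (cong (_+ c * (M * n)) (m≡m%n+[m/n]*n r M)) (expand (r % M) (r / M) c M n))
        where
        expand : ∀ a k c M n → a + k * M + c * (M * n) ≡ a + (k + c * n) * M
        expand = solve-∀

    point : ℕ → V
    point q = ModM.reduce q , reduce (height q)

    -- the lap u * (j - D x) in which the cycle passes through (x, j)
    lap : V → ℕ
    lap (x , j) = (u * (toℕ j + np * D (toℕ x))) % n

    index : V → ℕ
    index (x , j) = toℕ x + lap (x , j) * M

    lap<n : ∀ v → lap v < n
    lap<n (x , j) = m%n<n (u * (toℕ j + np * D (toℕ x))) n

    index<Mn : ∀ v → index v < M * n
    index<Mn (x , j) = mixed-radix-bound (toℕ<n x) (lap<n (x , j))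

    point-index : ∀ v → point (index v) ≡ v
    point-index (x , j) = cong₂ _,_ (ModM.reduce-≈ (ModM.+-multiple (toℕ x) k)) (reduce-≈ (begin
      height (toℕ x + k * M)          ≡⟨ height-at (toℕ x) k (<⇒≤ (toℕ<n x)) ⟩
      k * S + Dx                      ≈⟨ +-congʳ Dx (*-congʳ S (%-≈ w)) ⟩
      w * S + Dx                      ≡⟨ cong (_+ Dx) (rearrange u (toℕ j + np * Dx) S) ⟩
      u * S * (toℕ j + np * Dx) + Dx  ≈⟨ +-congʳ Dx (*-congʳ (toℕ j + np * Dx) u-inverse) ⟩
      1 * (toℕ j + np * Dx) + Dx      ≡⟨ cong (_+ Dx) (*-identityˡ (toℕ j + np * Dx)) ⟩
      toℕ j + np * Dx + Dx            ≈⟨ subtract-add (toℕ j) Dx ⟩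
      toℕ j                           ∎))
      where
      open ≈-Reasoning
      Dx = D (toℕ x)
      w = u * (toℕ j + np * Dx)
      k = lap (x , j)
      rearrange : ∀ u y S → u * y * S ≡ u * S * y
      rearrange = solve-∀

    lap-point : ∀ q → lap (point q) ≈ q / M
    lap-point q = begin
      lap (point q)                                        ≈⟨ %-≈ _ ⟩
      u * (toℕ (reduce (height q)) + np * D (toℕ (ModM.reduce q)))
        ≡⟨ cong (λ z → u * (toℕ (reduce (height q)) + np * D z)) (toℕ-fromℕ< (m%n<n q M)) ⟩
      u * (toℕ (reduce (height q)) + np * D (q % M))       ≈⟨ *-congˡ u (+-congʳ (np * D (q % M)) (toℕ-reduce _)) ⟩
      u * (q / M * S + D (q % M) + np * D (q % M))         ≈⟨ *-congˡ u (add-subtract (q / M * S) (D (q % M))) ⟩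
      u * (q / M * S)                                      ≡⟨ rearrange u (q / M) S ⟩
      u * S * (q / M)                                      ≈⟨ *-congʳ (q / M) u-inverse ⟩
      1 * (q / M)                                          ≡⟨ *-identityˡ (q / M) ⟩
      q / M                                                ∎
      where
      open ≈-Reasoning
      rearrange : ∀ u k S → u * (k * S) ≡ u * S * k
      rearrange = solve-∀

    index-point : ∀ q → q < M * n → index (point q) ≡ q
    index-point q q<Mn = begin
      index (point q)          ≡⟨ cong₂ (λ r k → r + k * M) (toℕ-fromℕ< (m%n<n q M)) lap≡ ⟩
      q % M + q / M * M        ≡⟨ m≡m%n+[m/n]*n q M ⟨
      q                        ∎
      where
      open ≡-Reasoning
      lap≡ : lap (point q) ≡ q / M
      lap≡ = canonical (lap<n (point q)) (m<n*o⇒m/o<n (subst (q <_) (*-comm M n) q<Mn)) (lap-point q)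

    vertex : Fin 1 × Fin (M * n) → V
    vertex (_ , q) = point (toℕ q)

    position : V → Fin 1 × Fin (M * n)
    position v = zero , fromℕ< (index<Mn v)

    vertex-position : ∀ v → vertex (position v) ≡ v
    vertex-position v = trans (cong point (toℕ-fromℕ< (index<Mn v))) (point-index v)

    position-vertex : ∀ a → position (vertex a) ≡ a
    position-vertex (zero , q) =
      cong (zero ,_) (toℕ-injective (trans (toℕ-fromℕ< (index<Mn (vertex (zero , q))))
                                           (index-point (toℕ q) (toℕ<n q))))

    follows : ∀ c q → Arc δ (vertex (c , q)) (vertex (c , next q))
    follows c q = arc layer shift
      where
      layer : next (ModM.reduce (toℕ q)) ≡ ModM.reduce (toℕ (next q))
      layer = sym (ModM.reduce-≈ (begin
        toℕ (next q)                      ≡⟨ toℕ-next q ⟩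
        suc (toℕ q) % (M * n)             ≈⟨ ModM.%-multiple-≈ (suc (toℕ q)) np ⟩
        suc (toℕ q)                       ≈⟨ ModM.+-congˡ 1 (ModM.toℕ-reduce (toℕ q)) ⟨
        suc (toℕ (ModM.reduce (toℕ q)))   ≈⟨ ModM.%-≈ _ ⟨
        suc (toℕ (ModM.reduce (toℕ q))) % M ≡⟨ toℕ-next (ModM.reduce (toℕ q)) ⟨
        toℕ (next (ModM.reduce (toℕ q)))  ∎))
        where open ModM.≈-Reasoning
      shift : toℕ (reduce (height (toℕ q))) + δ (toℕ (ModM.reduce (toℕ q)))
              ≈ toℕ (reduce (height (toℕ (next q))))
      shift = begin
        toℕ (reduce (height (toℕ q))) + δ (toℕ (ModM.reduce (toℕ q)))
          ≈⟨ +-cong (toℕ-reduce _) (≡⇒≈ (cong δ (toℕ-fromℕ< (m%n<n (toℕ q) M)))) ⟩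
        height (toℕ q) + δ (toℕ q % M)        ≡⟨ height-suc (toℕ q) ⟨
        height (suc (toℕ q))                  ≈⟨ height-periodic (suc (toℕ q)) ⟨
        height (suc (toℕ q) % (M * n))        ≡⟨ cong height (toℕ-next q) ⟨
        height (toℕ (next q))                 ≈⟨ toℕ-reduce _ ⟨
        toℕ (reduce (height (toℕ (next q))))  ∎
        where open ≈-Reasoning

    longFactor : ShiftFactor δ (M * n)
    longFactor = shiftFactor vertex position position-vertex vertex-position follows

  -- A shift design for β: n shift sequences d t (t < n) such that at every
  -- layer x each residue r is taken by exactly one of them (namely by
  -- d (col x r)), the sequences t ≥ β have total shift 0 and the sequences
  -- t < β have a unit total shift.
  record ShiftDesign (β : ℕ) : Set where
    field
      d       : ℕ → ℕ → ℕ
      col     : ℕ → ℕ → ℕ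
      col<n   : ∀ x r → r < n → col x r < n
      col-sec : ∀ x r → d (col x r) x ≈ r
      col-inj : ∀ x {t t'} → t < n → t' < n → d t x ≈ d t' x → t ≡ t'
      short   : ∀ t → β ≤ t → t < n → total (d t) ≈ 0
      long    : ∀ t → t < β → Unit (total (d t))

  -- A shift design yields a partition of E(C_M[n]) into n - β C_M-factors
  -- (the sequences t ≥ β) and β Hamiltonian cycles (the sequences t < β):
  -- the edge (x, i)(x + 1, j) lies in the factor of the unique sequence with
  -- shift j - i at layer x.
  module Partition (M>2 : 3 ≤ M) {β} (β≤n : β ≤ n) (design : ShiftDesign β) where
    open ShiftDesign design

    α : ℕ
    α = n ∸ β

    Colour : Set
    Colour = Fin α ⊎ Fin β

    type : Colour → ℕ
    type (inj₁ a) = β + toℕ a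
    type (inj₂ b) = toℕ b

    type<n : ∀ τ → type τ < n
    type<n (inj₁ a) = subst (β + toℕ a <_) (m+[n∸m]≡n β≤n) (+-monoʳ-< β (toℕ<n a))
    type<n (inj₂ b) = <-≤-trans (toℕ<n b) β≤n

    type-injective : ∀ τ τ' → type τ ≡ type τ' → τ ≡ τ'
    type-injective (inj₁ a) (inj₁ a') eq = cong inj₁ (toℕ-injective (+-cancelˡ-≡ β _ _ eq))
    type-injective (inj₂ b) (inj₂ b') eq = cong inj₂ (toℕ-injective eq)
    type-injective (inj₁ a) (inj₂ b) eq =
      ⊥-elim (<⇒≱ (toℕ<n b) (subst (β ≤_) eq (m≤m+n β (toℕ a))))
    type-injective (inj₂ b) (inj₁ a) eq =
      ⊥-elim (<⇒≱ (toℕ<n b) (subst (β ≤_) (sym eq) (m≤m+n β (toℕ a))))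

    colour-of : ∀ t → t < n → Σ Colour λ τ → type τ ≡ t
    colour-of t t<n with t <? β
    ... | yes t<β = inj₂ (fromℕ< t<β) , toℕ-fromℕ< t<β
    ... | no t≮β = inj₁ (fromℕ< (∸-monoˡ-< t<n β≤t)) ,
                   trans (cong (β +_) (toℕ-fromℕ< _)) (m+[n∸m]≡n β≤t)
      where
      β≤t = ≮⇒≥ t≮β

    length : Colour → ℕ
    length (inj₁ _) = M
    length (inj₂ _) = M * n

    factor : ∀ τ → ShiftFactor (d (type τ)) (length τ)
    factor (inj₁ a) = ShortCycles.shortFactor (d (β + toℕ a))
                        (short (β + toℕ a) (m≤m+n β (toℕ a)) (type<n (inj₁ a)))
    factor (inj₂ b) with long (toℕ b) (toℕ<n b)
    ... | u , u-inverse = LongCycle.longFactor (d (toℕ b)) u u-inverse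

    InFactor : Colour → V → V → Set
    InFactor τ u v = EdgeOf (proj₁ (factor τ)) u v

    unique-forward : ∀ x i y j → next x ≡ y → ∃! _≡_ (λ τ → InFactor τ (x , i) (y , j))
    unique-forward x i y j x→y = τ₀ , Edges.arc⇒edge (factor τ₀) arc₀ , uniqueness
      where
      open ≈-Reasoning
      r = reduce (toℕ j + np * toℕ i)
      t₀ = col (toℕ x) (toℕ r)
      τ₀ = proj₁ (colour-of t₀ (col<n (toℕ x) (toℕ r) (toℕ<n r)))
      type-τ₀ = proj₂ (colour-of t₀ (col<n (toℕ x) (toℕ r) (toℕ<n r)))

      shift₀ : toℕ i + d t₀ (toℕ x) ≈ toℕ j
      shift₀ = begin
        toℕ i + d t₀ (toℕ x)         ≈⟨ +-congˡ (toℕ i) (≈-trans (col-sec (toℕ x) (toℕ r)) (toℕ-reduce _)) ⟩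
        toℕ i + (toℕ j + np * toℕ i) ≡⟨ regroup (toℕ i) (toℕ j) (np * toℕ i) ⟩
        toℕ j + toℕ i + np * toℕ i   ≈⟨ add-subtract (toℕ j) (toℕ i) ⟩
        toℕ j                        ∎
        where
        regroup : ∀ a b c → a + (b + c) ≡ b + a + c
        regroup = solve-∀

      arc₀ : Arc (d (type τ₀)) (x , i) (y , j)
      arc₀ = arc x→y (subst (λ t → toℕ i + d t (toℕ x) ≈ toℕ j) (sym type-τ₀) shift₀)

      uniqueness : ∀ {τ} → InFactor τ (x , i) (y , j) → τ₀ ≡ τ
      uniqueness {τ} e with Edges.edge⇒arc (factor τ) e
      ... | inj₂ (arc y→x _) = ⊥-elim (next²≢id M>2 x (trans (cong next x→y) y→x))
      ... | inj₁ (arc _ shift) = type-injective τ₀ τ (trans type-τ₀ (sym same-type))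
        where
        same-type : type τ ≡ t₀
        same-type = col-inj (toℕ x) (type<n τ) (col<n (toℕ x) (toℕ r) (toℕ<n r))
                      (+-cancelˡ (≈-trans shift (≈-sym shift₀)))

    unique : ∀ u v → Adj u v → ∃! _≡_ (λ τ → InFactor τ u v)
    unique (x , i) (y , j) (inj₁ x→y) = unique-forward x i y j x→y
    unique (x , i) (y , j) (inj₂ y→x) with unique-forward y j x i y→x
    ... | τ , e , only = τ , EdgeOf-sym (proj₁ (factor τ)) e ,
                         λ {τ'} e' → only (EdgeOf-sym (proj₁ (factor τ')) e')

    partition : HWP V Adj M (M * n) α β
    partition = (λ a → proj₁ (factor (inj₁ a))) , (λ b → proj₁ (factor (inj₂ b))) ,
      λ u v uv → case unique u v uv of λ
        { (inj₁ a , e , only) → inj₁ a , e , λ { {inj₁ _} → only ; {inj₂ _} → only }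
        ; (inj₂ b , e , only) → inj₂ b , e , λ { {inj₁ _} → only ; {inj₂ _} → only } }

dbl : ℕ → ℕ
dbl zero = 0
dbl (suc k) = suc (suc (dbl k))

data Parity : ℕ → Set where
  even : ∀ k → Parity (dbl k)
  odd  : ∀ k → Parity (suc (dbl k))

parity : ∀ m → Parity m
parity zero = even 0
parity (suc m) with parity m
... | even k = odd k
... | odd k = even (suc k)

Displacement : ℕ → ℕ → Set
Displacement t a = (a ≡ suc t) ⊎ (suc a ≡ t) ⊎ (2 + a ≡ t)

Displacement-suc : ∀ {t a} → Displacement t a → Displacement (suc t) (suc a)
Displacement-suc (inj₁ e) = inj₁ (cong suc e)
Displacement-suc (inj₂ (inj₁ e)) = inj₂ (inj₁ (cong suc e))
Displacement-suc (inj₂ (inj₂ e)) = inj₂ (inj₂ (cong suc e))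

-- These are the layer-0 shifts of the construction: colour t ends up with
-- total shift π t - t, which is 0 for t ≥ β and ±1 or -2 for t < β.
record Exchange (β : ℕ) : Set where
  field
    π π⁻¹  : ℕ → ℕ
    π⁻¹∘π  : ∀ t → π⁻¹ (π t) ≡ t
    π∘π⁻¹  : ∀ t → π (π⁻¹ t) ≡ t
    fixed  : ∀ t → β ≤ t → π t ≡ t
    moved  : ∀ t → t < β → Displacement t (π t)

module _ {f g : ℕ → ℕ} {β : ℕ} (g∘f : ∀ t → g (f t) ≡ t) (f-fixed : ∀ t → β ≤ t → f t ≡ t) where
  fixed-if-beyond : ∀ t → β ≤ f t → f t ≡ t
  fixed-if-beyond t β≤ft = trans (sym (g∘f (f t))) (trans (cong g (f-fixed (f t) β≤ft)) (g∘f t))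

  maps-below : ∀ {N} → β ≤ N → ∀ t → t < N → f t < N
  maps-below β≤N t t<N with β ≤? f t
  ... | yes β≤ft = subst (_< _) (sym (fixed-if-beyond t β≤ft)) t<N
  ... | no β≰ft = <-≤-trans (≰⇒> β≰ft) β≤N

module ExchangeProperties {β} (ex : Exchange β) where
  open Exchange ex

  π⁻¹-fixed : ∀ t → β ≤ t → π⁻¹ t ≡ t
  π⁻¹-fixed t β≤t = trans (cong π⁻¹ (sym (fixed t β≤t))) (π⁻¹∘π t)

  π<n : ∀ {n} → β ≤ n → ∀ t → t < n → π t < n
  π<n = maps-below {g = π⁻¹} π⁻¹∘π fixed

  π⁻¹<n : ∀ {n} → β ≤ n → ∀ t → t < n → π⁻¹ t < n
  π⁻¹<n = maps-below {g = π} π∘π⁻¹ π⁻¹-fixed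

swaps : ℕ → ℕ → ℕ
swaps zero t = t
swaps (suc m) zero = 1
swaps (suc m) (suc zero) = 0
swaps (suc m) (suc (suc t)) = suc (suc (swaps m t))

swaps-involutive : ∀ m t → swaps m (swaps m t) ≡ t
swaps-involutive zero t = refl
swaps-involutive (suc m) zero = refl
swaps-involutive (suc m) (suc zero) = refl
swaps-involutive (suc m) (suc (suc t)) = cong (λ z → suc (suc z)) (swaps-involutive m t)

swaps-fixed : ∀ m t → dbl m ≤ t → swaps m t ≡ t
swaps-fixed zero t _ = refl
swaps-fixed (suc m) (suc (suc t)) (s≤s (s≤s le)) = cong (λ z → suc (suc z)) (swaps-fixed m t le)

swaps-moved : ∀ m t → t < dbl m → Displacement t (swaps m t)
swaps-moved (suc m) zero _ = inj₁ refl
swaps-moved (suc m) (suc zero) _ = inj₂ (inj₁ refl)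
swaps-moved (suc m) (suc (suc t)) (s≤s (s≤s lt)) = Displacement-suc (Displacement-suc (swaps-moved m t lt))

swapExchange : ∀ m → Exchange (dbl m)
swapExchange m = record
  { π = swaps m ; π⁻¹ = swaps m
  ; π⁻¹∘π = swaps-involutive m ; π∘π⁻¹ = swaps-involutive m
  ; fixed = swaps-fixed m ; moved = swaps-moved m }

rotate rotate⁻¹ : ℕ → ℕ → ℕ
rotate m zero = 1
rotate m (suc zero) = 2
rotate m (suc (suc zero)) = 0
rotate m (suc (suc (suc t))) = 3 + swaps m t
rotate⁻¹ m zero = 2
rotate⁻¹ m (suc zero) = 0
rotate⁻¹ m (suc (suc zero)) = 1
rotate⁻¹ m (suc (suc (suc t))) = 3 + swaps m t

rotate⁻¹∘rotate : ∀ m t → rotate⁻¹ m (rotate m t) ≡ t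
rotate⁻¹∘rotate m zero = refl
rotate⁻¹∘rotate m (suc zero) = refl
rotate⁻¹∘rotate m (suc (suc zero)) = refl
rotate⁻¹∘rotate m (suc (suc (suc t))) = cong (3 +_) (swaps-involutive m t)

rotate∘rotate⁻¹ : ∀ m t → rotate m (rotate⁻¹ m t) ≡ t
rotate∘rotate⁻¹ m zero = refl
rotate∘rotate⁻¹ m (suc zero) = refl
rotate∘rotate⁻¹ m (suc (suc zero)) = refl
rotate∘rotate⁻¹ m (suc (suc (suc t))) = cong (3 +_) (swaps-involutive m t)

rotate-fixed : ∀ m t → 3 + dbl m ≤ t → rotate m t ≡ t
rotate-fixed m (suc (suc (suc t))) (s≤s (s≤s (s≤s le))) = cong (3 +_) (swaps-fixed m t le)

rotate-moved : ∀ m t → t < 3 + dbl m → Displacement t (rotate m t)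
rotate-moved m zero _ = inj₁ refl
rotate-moved m (suc zero) _ = inj₁ refl
rotate-moved m (suc (suc zero)) _ = inj₂ (inj₂ refl)
rotate-moved m (suc (suc (suc t))) (s≤s (s≤s (s≤s lt))) =
  Displacement-suc (Displacement-suc (Displacement-suc (swaps-moved m t lt)))

rotateExchange : ∀ m → Exchange (3 + dbl m)
rotateExchange m = record
  { π = rotate m ; π⁻¹ = rotate⁻¹ m
  ; π⁻¹∘π = rotate⁻¹∘rotate m ; π∘π⁻¹ = rotate∘rotate⁻¹ m
  ; fixed = rotate-fixed m ; moved = rotate-moved m }

-- Every β ≠ 1 admits an exchange (β = 1 is exactly the excluded case:
-- a permutation of {0} cannot move 0).
exchange : ∀ β → β ≢ 1 → Exchange β
exchange β β≢1 with parity β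
... | even m = swapExchange m
... | odd zero = ⊥-elim (β≢1 refl)
... | odd (suc m) = rotateExchange m

odd-half : ∀ np → suc np % 2 ≡ 1 → np ≡ suc np / 2 + suc np / 2
odd-half np n-odd = trans (suc-injective (trans (m≡m%n+[m/n]*n (suc np) 2) (cong (_+ h * 2) n-odd)))
                        (trans (*-comm h 2) (cong (h +_) (+-identityʳ h)))
  where
  h = suc np / 2

module OddModulus (np h : ℕ) (n-odd : np ≡ h + h) where
  open Congruence np

  -- -1 and -2 are units mod n (the latter because n is odd)
  unit-if-minus-one : ∀ {x} → x + 1 ≈ 0 → Unit x
  unit-if-minus-one = unit-of-negative 1 np (*-identityʳ np)

  unit-if-minus-two : ∀ {x} → x + 2 ≈ 0 → Unit x
  unit-if-minus-two = unit-of-negative 2 h (trans (*-comm h 2) (trans (cong (h +_) (+-identityʳ h)) (sym n-odd)))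

  displacement-unit : ∀ {S t a} → S + t ≈ a → Displacement t a → Unit S
  displacement-unit {S} {t} {a} p (inj₁ refl) = unit-one (+-cancelʳ p)
  displacement-unit {S} {t} {a} p (inj₂ (inj₁ refl)) =
    unit-if-minus-one (+-cancelʳ (≈-trans (≡⇒≈ (+-assoc S 1 a)) p))
  displacement-unit {S} {t} {a} p (inj₂ (inj₂ refl)) =
    unit-if-minus-two (+-cancelʳ (≈-trans (≡⇒≈ (+-assoc S 2 a)) p))

  record Multipliers (M : ℕ) : Set where
    field
      e      : ℕ → ℕ
      e-unit : ∀ x → Unit (e x)
      e₀     : e 0 ≡ 1
      e-sum  : sumTo e M ≈ 0

  alternating : ℕ → ℕ
  alternating zero = 1
  alternating (suc zero) = np
  alternating (suc (suc x)) = alternating x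

  alternating-unit : ∀ x → Unit (alternating x)
  alternating-unit zero = unit-one ≈-refl
  alternating-unit (suc zero) = unit-if-minus-one (≈-trans (≡⇒≈ (once np)) (+-multiple 0 1))
    where
    once : ∀ np → np + 1 ≡ 1 * (1 + np)
    once = solve-∀
  alternating-unit (suc (suc x)) = alternating-unit x

  alternating-sum : ∀ k → sumTo alternating (dbl k) ≡ k * N
  alternating-sum zero = refl
  alternating-sum (suc k) = begin
    sumTo alternating (dbl k) + alternating (dbl k) + alternating (suc (dbl k))
      ≡⟨ cong₂ (λ a b → sumTo alternating (dbl k) + a + b) (at-even k) (at-odd k) ⟩
    sumTo alternating (dbl k) + 1 + np  ≡⟨ cong (λ s → s + 1 + np) (alternating-sum k) ⟩
    k * N + 1 + np                      ≡⟨ regroup k np ⟩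
    suc k * N                           ∎
    where
    open ≡-Reasoning
    at-even : ∀ k → alternating (dbl k) ≡ 1
    at-even zero = refl
    at-even (suc k) = at-even k
    at-odd : ∀ k → alternating (suc (dbl k)) ≡ np
    at-odd zero = refl
    at-odd (suc k) = at-odd k
    regroup : ∀ k np → k * (1 + np) + 1 + np ≡ (1 + k) * (1 + np)
    regroup = solve-∀

  oddStart : ℕ → ℕ
  oddStart zero = 1
  oddStart (suc zero) = 1
  oddStart (suc (suc zero)) = np + np
  oddStart (suc (suc (suc x))) = alternating x

  oddStart-unit : ∀ x → Unit (oddStart x)
  oddStart-unit zero = unit-one ≈-refl
  oddStart-unit (suc zero) = unit-one ≈-refl
  oddStart-unit (suc (suc zero)) = unit-if-minus-two (≈-trans (≡⇒≈ (twice np)) (+-multiple 0 2))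
    where
    twice : ∀ np → np + np + 2 ≡ 2 * (1 + np)
    twice = solve-∀
  oddStart-unit (suc (suc (suc x))) = alternating-unit x

  oddStart-sum : ∀ y → sumTo oddStart (3 + y) ≡ 2 * N + sumTo alternating y
  oddStart-sum zero = start np
    where
    start : ∀ np → 0 + 1 + 1 + (np + np) ≡ 2 * (1 + np) + 0
    start = solve-∀
  oddStart-sum (suc y) = trans (cong (_+ alternating y) (oddStart-sum y)) (+-assoc (2 * N) _ _)

  multipliers : ∀ M → 3 ≤ M → Multipliers M
  multipliers M M≥3 with parity M
  ... | even k = record { e = alternating ; e-unit = alternating-unit ; e₀ = refl
                        ; e-sum = ≈-trans (≡⇒≈ (alternating-sum k)) (+-multiple 0 k) }
  ... | odd zero = ⊥-elim (<⇒≱ M≥3 (s≤s z≤n))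
  ... | odd (suc k) = record { e = oddStart ; e-unit = oddStart-unit ; e₀ = refl
                             ; e-sum = ≈-trans (≡⇒≈ sum) (+-multiple 0 (2 + k)) }
    where
    regroup : ∀ N k → 2 * N + k * N ≡ (2 + k) * N
    regroup = solve-∀
    sum : sumTo oddStart (3 + dbl k) ≡ (2 + k) * N
    sum = trans (oddStart-sum (dbl k)) (trans (cong (2 * N +_) (alternating-sum k)) (regroup N k))

  -- The shift design: colour t uses shift π t at layer 0 and e x * t at
  -- layer x > 0.  Since the e x sum to 0 and e 0 = 1, its total shift is
  -- π t - t; at each layer the shifts are a permutation of ℤ_n because π
  -- is a permutation and e x is a unit.
  module Design (M' : ℕ) {β} (β≤n : β ≤ N) (mult : Multipliers (suc M')) (ex : Exchange β) where
    open ShiftFactors M' np using (total; ShiftDesign)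
    open Multipliers mult
    open Exchange ex
    open ExchangeProperties ex

    d : ℕ → ℕ → ℕ
    d t zero = π t
    d t (suc x) = e (suc x) * t

    partial-shift : ∀ t p → sumTo (d t) (suc p) + t ≡ π t + sumTo e (suc p) * t
    partial-shift t zero = cong (π t +_) (sym (trans (cong (_* t) e₀) (*-identityˡ t)))
    partial-shift t (suc p) = begin
      sumTo (d t) (suc p) + e (suc p) * t + t   ≡⟨ swap-last (sumTo (d t) (suc p)) (e (suc p) * t) t ⟩
      sumTo (d t) (suc p) + t + e (suc p) * t   ≡⟨ cong (_+ e (suc p) * t) (partial-shift t p) ⟩
      π t + sumTo e (suc p) * t + e (suc p) * t ≡⟨ collect (π t) (sumTo e (suc p)) (e (suc p)) t ⟩
      π t + sumTo e (suc (suc p)) * t           ∎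
      where
      open ≡-Reasoning
      swap-last : ∀ a b c → a + b + c ≡ a + c + b
      swap-last = solve-∀
      collect : ∀ a s f t → a + s * t + f * t ≡ a + (s + f) * t
      collect = solve-∀

    total-shift : ∀ t → total (d t) + t ≈ π t
    total-shift t = begin
      total (d t) + t                ≡⟨ partial-shift t M' ⟩
      π t + sumTo e (suc M') * t     ≈⟨ +-congˡ (π t) (*-congʳ t e-sum) ⟩
      π t + 0                        ≡⟨ +-identityʳ (π t) ⟩
      π t                            ∎
      where open ≈-Reasoning

    inverse : ℕ → ℕ
    inverse x = proj₁ (e-unit x)

    col : ℕ → ℕ → ℕ
    col zero r = π⁻¹ r
    col (suc x) r = (inverse (suc x) * r) % N

    col<n : ∀ x r → r < N → col x r < N
    col<n zero r r<n = π⁻¹<n β≤n r r<n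
    col<n (suc x) r _ = m%n<n (inverse (suc x) * r) N

    col-sec : ∀ x r → d (col x r) x ≈ r
    col-sec zero r = ≡⇒≈ (π∘π⁻¹ r)
    col-sec (suc x) r = begin
      e (suc x) * ((w * r) % N)  ≈⟨ *-congˡ (e (suc x)) (%-≈ (w * r)) ⟩
      e (suc x) * (w * r)        ≡⟨ x*-comm (e (suc x)) w r ⟩
      w * (e (suc x) * r)        ≈⟨ unit-cancel (e (suc x)) (e-unit (suc x)) r ⟩
      r                          ∎
      where
      open ≈-Reasoning
      w = inverse (suc x)
      x*-comm : ∀ a b c → a * (b * c) ≡ b * (a * c)
      x*-comm = solve-∀

    col-inj : ∀ x {t t'} → t < N → t' < N → d t x ≈ d t' x → t ≡ t'
    col-inj zero {t} {t'} t<n t'<n p = begin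
      t            ≡⟨ π⁻¹∘π t ⟨
      π⁻¹ (π t)    ≡⟨ cong π⁻¹ (canonical (π<n β≤n t t<n) (π<n β≤n t' t'<n) p) ⟩
      π⁻¹ (π t')   ≡⟨ π⁻¹∘π t' ⟩
      t'           ∎
      where open ≡-Reasoning
    col-inj (suc x) {t} {t'} t<n t'<n p = canonical t<n t'<n (begin
      t                            ≈⟨ unit-cancel (e (suc x)) (e-unit (suc x)) t ⟨
      inverse (suc x) * d t (suc x)  ≈⟨ *-congˡ (inverse (suc x)) p ⟩
      inverse (suc x) * d t' (suc x) ≈⟨ unit-cancel (e (suc x)) (e-unit (suc x)) t' ⟩
      t'                           ∎)
      where open ≈-Reasoning

    design : ShiftDesign β
    design = record
      { d = d ; col = col ; col<n = col<n ; col-sec = col-sec ; col-inj = col-inj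
      ; short = λ t β≤t _ → +-cancelʳ (≈-trans (total-shift t) (≡⇒≈ (fixed t β≤t)))
      ; long = λ t t<β → displacement-unit (total-shift t) (moved t t<β) }

lemma3p1 : ∀ (M n : ℕ) → 3 ≤ M → 3 ≤ n → n % 2 ≡ 1 →
    ∀ (β : ℕ) → β ≤ n → β ≢ 1 →
    HWP (LexV M n) (LexAdj M n) M (M * n) (n ∸ β) β
lemma3p1 (suc M') (suc np) M≥3 _ n-odd β β≤n β≢1 =
  Partition.partition M≥3 β≤n (Design.design M' β≤n (multipliers (suc M') M≥3) (exchange β β≢1))
  where
  open ShiftFactors M' np using (module Partition)
  open OddModulus np (suc np / 2) (odd-half np n-odd)
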